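{- Let $r\ge1$, $a_1,\dots,a_r\in\mathbb{N}$ and $f(x)=(x+a_1)\cdots(x+a_r)$. For all $n,k\in\mathbb{N}$, $e_n(f(1),\dots,f(k))$ equals the number of $r$-tuples $(\sigma_1,\dots,\sigma_r)\in S_{k+1+a_1}\times\cdots\times S_{k+1+a_r}$ such that all $\sigma_i$ have the same ordered cycle structure up to $k+1-n$ and each $\sigma_i$ has exactly $k+1-n+a_i$ cycles.
   Context: $e_n$ is the elementary symmetric polynomial of degree $n$. For a permutation, write each cycle with its minimum first and order the cycles by increasing minima; the ordered cycle structure is the resulting sequence of cycle lengths. Permutations have the same ordered cycle structure up to $m$ if the first $m$ entries of their cycle-length sequences coincide and all their remaining cycles have length $1$. -}

module Defs where

open import Data.Nat using (ℕ; zero; suc; _+_; _*_; _∸_; _≤ᵇ_)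
import Data.Nat as ℕ
open import Data.Bool using (Bool; true; false; T; _∧_; if_then_else_)
open import Data.Fin using (Fin; toℕ)
import Data.Fin as Fin
open import Data.Fin.Properties using () renaming (_≟_ to _≟ᶠ_)
open import Data.Vec using (Vec; []; _∷_; lookup; toList)
open import Data.Nat.ListAction using (sum; product)
open import Data.List using (List; []; _∷_; _++_; map; filter; length; take; drop; upTo; allFin; foldr)
open import Data.List.Relation.Unary.All using (All)
open import Data.List.Relation.Unary.AllPairs using (AllPairs)
open import Data.Product using (Σ; _×_; _,_; proj₁; proj₂)
open import Data.Unit using (⊤)
open import Relation.Nullary using (does)
open import Relation.Binary.PropositionalEquality using (_≡_)

sublists : {A : Set} → List A → List (List A)
sublists [] = [] ∷ []
sublists (x ∷ xs) = sublists xs ++ map (x ∷_) (sublists xs)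

esym : ℕ → List ℕ → ℕ
esym n xs = sum (map product (filter (λ s → length s ℕ.≟ n) (sublists xs)))

fpoly : {r : ℕ} → Vec ℕ r → ℕ → ℕ
fpoly [] x = 1
fpoly (a ∷ as) x = (x + a) * fpoly as x

oneTo : ℕ → List ℕ
oneTo k = map suc (upTo k)

-- Permutations of {0,...,N-1}: S_N, represented by the table
-- (σ(0),...,σ(N-1)) of an injective (hence bijective) map Fin N → Fin N.

injectiveᵇ : {N : ℕ} → Vec (Fin N) N → Bool
injectiveᵇ v = does (unique? (toList v))
  where open import Data.List.Relation.Unary.Unique.DecPropositional _≟ᶠ_ using (unique?)

Perm : ℕ → Set
Perm N = Σ (Vec (Fin N) N) (λ v → T (injectiveᵇ v))

app : {N : ℕ} → Perm N → Fin N → Fin N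
app σ i = lookup (proj₁ σ) i

iter : {N : ℕ} → Perm N → ℕ → Fin N → Fin N
iter σ zero i = i
iter σ (suc t) i = app σ (iter σ t i)

firstOr : ℕ → (ℕ → Bool) → List ℕ → ℕ
firstOr d p [] = d
firstOr d p (t ∷ ts) = if p t then t else firstOr d p ts

-- length of the cycle of σ containing i: least t ≥ 1 with σ^t(i) = i
-- (such t ≤ N always exists for a permutation of N points)
cycleLen : {N : ℕ} → Perm N → Fin N → ℕ
cycleLen {N} σ i = firstOr N (λ t → does (iter σ t i ≟ᶠ i)) (oneTo N)

isCycleMin : {N : ℕ} → Perm N → Fin N → Bool
isCycleMin {N} σ i = foldr (λ t b → (toℕ i ≤ᵇ toℕ (iter σ t i)) ∧ b) true (upTo N)

-- ordered cycle structure: cycles written with minimum first, ordered by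
-- increasing minima; the resulting sequence of cycle lengths
-- (allFin N enumerates 0,1,...,N-1 in increasing order)
cycleStructure : {N : ℕ} → Perm N → List ℕ
cycleStructure {N} σ = map (cycleLen σ) (filter (λ i → T? (isCycleMin σ i)) (allFin N))
  where open import Relation.Nullary.Decidable using () renaming (T? to T?)

numCycles : {N : ℕ} → Perm N → ℕ
numCycles σ = length (cycleStructure σ)

Tuples : (k : ℕ) → {r : ℕ} → Vec ℕ r → Set
Tuples k [] = ⊤
Tuples k (a ∷ as) = Perm (k + 1 + a) × Tuples k as

structures : (k : ℕ) → {r : ℕ} → (as : Vec ℕ r) → Tuples k as → List (List ℕ × ℕ)
structures k [] _ = []
structures k (a ∷ as) (σ , τ) = (cycleStructure σ , a) ∷ structures k as τ

SameUpTo : ℕ → List ℕ → List ℕ → Set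
SameUpTo m c c' = take m c ≡ take m c' × All (_≡ 1) (drop m c) × All (_≡ 1) (drop m c')

Good : (k m : ℕ) → {r : ℕ} → (as : Vec ℕ r) → Tuples k as → Set
Good k m as τ =
  AllPairs (λ p q → SameUpTo m (proj₁ p) (proj₁ q)) (structures k as τ)
  × All (λ p → All (_≡ 1) (drop m (proj₁ p)) × length (proj₁ p) ≡ m + proj₂ p) (structures k as τ)

-- Sending ρ ∈ S_{N+1} to its value p = ρ(0) and the permutation of the remaining N points obtained
-- by cutting p out of the cycle of 0 is a bijection S_{N+1} ≅ [N+1] × S_N.  If p = 0 the ordered
-- cycle structure of ρ is that of the smaller permutation preceded by a 1; otherwise it is that
-- structure with its first entry increased by one.  So S_{N+1} has as many permutations of ordered
-- cycle structure (1, c₂, …) as S_N has of (c₂, …), and N times as many of (c₁ + 1, c₂, …) as S_N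
-- has of (c₁, c₂, …).  Count r-tuples in S_{K+a₁} × ⋯ × S_{K+a_r} whose structures are a common
-- list c of length m followed by fixed points (so c sums to K) and split on the first entry of c:
-- this count T(K, m) satisfies T(K+1, m+1) = T(K, m) + f(K) T(K, m+1), with T(K, K) = 1 and
-- T(K, m) = 0 for m > K or m = 0 < K.  The same recursion, with f(k+1) the new variable, computes
-- e_{n+1}(f(1), …, f(k+1)) = e_{n+1}(f(1), …, f(k)) + f(k+1) e_n(f(1), …, f(k)), whence
-- e_n(f(1), …, f(k)) = T(k+1, k+1-n); finally the good tuples are exactly those sharing such a c.

module Submission where

open import Defs
open import Data.Nat using (ℕ; zero; suc; pred; _+_; _*_; _∸_; _≤_; _<_; _≤ᵇ_; z≤n; s≤s; s≤s⁻¹)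
open import Data.Nat.Properties
open import Data.Nat.ListAction using (sum; product)
open import Data.Nat.ListAction.Properties using (sum-++)
open import Data.Nat.Solver using (module +-*-Solver)
open +-*-Solver using (solve; _:+_; _:*_; con; _:=_)
open import Data.Bool using (Bool; true; false; T; _∧_)
open import Data.Bool.Properties using (T-irrelevant; T-∧; T-≡)
open import Data.Fin using (Fin; zero; suc; toℕ; punchIn; punchOut)
import Data.Fin as Fin
import Data.Fin.Properties as Finₚ
open import Data.Vec using (Vec; []; _∷_; lookup; toList; tabulate)
import Data.Vec.Properties as Vecₚ
import Data.Vec.Relation.Unary.All.Properties as VecAllₚ
open import Data.List using (List; []; _∷_; _++_; map; filter; length; upTo; allFin; applyUpTo; foldr)
import Data.List as List
import Data.List.Properties as Listₚ
open import Data.List.Relation.Unary.All using (All; []; _∷_)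
import Data.List.Relation.Unary.All as All
import Data.List.Relation.Unary.All.Properties as Allₚ
open import Data.List.Relation.Unary.AllPairs using (AllPairs; []; _∷_)
import Data.List.Relation.Unary.AllPairs as AllPairs
open import Data.List.Relation.Unary.Unique.Propositional using (Unique)
import Data.List.Relation.Unary.Unique.Propositional.Properties as Uniqueₚ
import Data.List.Relation.Unary.Unique.DecPropositional as UniqueDec
open import Data.List.Relation.Unary.Any using (satisfied)
open import Data.Product using (Σ; _×_; _,_; proj₁; proj₂; ∃)
open import Data.Product.Properties using (Σ-≡,≡→≡)
open import Data.Unit using (⊤)
open import Data.Sum using (_⊎_; inj₁; inj₂; [_,_]; [_,_]′)
open import Data.Empty using (⊥-elim)
open import Relation.Nullary using (Dec; yes; no; does; ¬_; contradiction; Irrelevant)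
open import Relation.Nullary.Decidable using (T?; does-⇔)
open import Relation.Binary.PropositionalEquality hiding ([_])
open import Relation.Binary.Definitions using (tri<; tri≈; tri>)
open import Function using (_∘_; id; _⇔_; mk⇔; Equivalence)
open import Function.Definitions using (Injective)
open import Function.Bundles using (_↔_; mk↔ₛ′; Inverse)
open import Function.Properties.Inverse using (↔-refl; ↔-sym; ↔-trans)
open import Function.Related.Propositional using (K-reflexive; module EquationalReasoning)
open import Function.Related.TypeIsomorphisms using (Σ-assoc; Σ-distribʳ-⊎; ∃∃↔∃∃)
open import Data.Product.Function.Dependent.Propositional using (Σ-↔)
open import Data.Product.Function.NonDependent.Propositional using (_×-↔_)
open import Data.Sum.Function.Propositional using (_⊎-↔_)
open import Axiom.UniquenessOfIdentityProofs.WithK using (uip)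

private variable
  N : ℕ

T-does⇔ : ∀ {P : Set} (d : Dec P) → T (does d) ⇔ P
T-does⇔ (yes p) = mk⇔ (λ _ → p) _
T-does⇔ (no ¬p) = mk⇔ (λ ()) ¬p

Bool-ext : {a b : Bool} → (T a ⇔ T b) → a ≡ b
Bool-ext {a} {b} h = does-⇔ h (T? a) (T? b)

T-foldr-∧ : (f : ℕ → Bool) (xs : List ℕ) → T (foldr (λ t b → f t ∧ b) true xs) ⇔ All (T ∘ f) xs
T-foldr-∧ f [] = mk⇔ (λ _ → []) _
T-foldr-∧ f (x ∷ xs) = mk⇔
  (λ h → let fx , rest = Equivalence.to T-∧ h in fx ∷ Equivalence.to (T-foldr-∧ f xs) rest)
  (λ { (fx ∷ rest) → Equivalence.from T-∧ (fx , Equivalence.from (T-foldr-∧ f xs) rest) })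

lookup-injective : ∀ {A : Set} {n} (v : Vec A n) → Unique (toList v) → Injective _≡_ _≡_ (lookup v)
lookup-injective (x ∷ v) _ {zero} {zero} _ = refl
lookup-injective (x ∷ v) (x∉v ∷ _) {zero} {suc j} e =
  contradiction e (VecAllₚ.lookup⁺ (VecAllₚ.toList⁻ x∉v) j)
lookup-injective (x ∷ v) (x∉v ∷ _) {suc i} {zero} e =
  contradiction (sym e) (VecAllₚ.lookup⁺ (VecAllₚ.toList⁻ x∉v) i)
lookup-injective (x ∷ v) (_ ∷ uv) {suc i} {suc j} e = cong suc (lookup-injective v uv e)

toList-tabulate : ∀ {A : Set} {n} (g : Fin n → A) → toList (tabulate g) ≡ List.tabulate g
toList-tabulate {n = zero} g = refl
toList-tabulate {n = suc n} g = cong (g zero ∷_) (toList-tabulate (g ∘ suc))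

tabulate-suc : ∀ n → List.tabulate {n = n} Fin.suc ≡ map Fin.suc (allFin n)
tabulate-suc n = sym (Listₚ.map-tabulate id suc)

filter-map : ∀ {A B : Set} (P : B → Bool) (f : A → B) (xs : List A) →
  filter (T? ∘ P) (map f xs) ≡ map f (filter (T? ∘ P ∘ f) xs)
filter-map P f [] = refl
filter-map P f (x ∷ xs) with P (f x)
... | true = cong (f x ∷_) (filter-map P f xs)
... | false = filter-map P f xs

filter-T?-cong : ∀ {A : Set} {P Q : A → Bool} → (∀ x → P x ≡ Q x) → filter (T? ∘ P) ≗ filter (T? ∘ Q)
filter-T?-cong e =
  Listₚ.filter-≐ (T? ∘ _) (T? ∘ _) ((λ {x} → subst T (e x)) , (λ {x} → subst T (sym (e x))))

take-length-++ : (c d : List ℕ) → List.take (length c) (c ++ d) ≡ c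
take-length-++ [] d = refl
take-length-++ (x ∷ c) d = cong (x ∷_) (take-length-++ c d)

drop-length-++ : (c d : List ℕ) → List.drop (length c) (c ++ d) ≡ d
drop-length-++ [] d = refl
drop-length-++ (x ∷ c) d = drop-length-++ c d

all≡1⇒replicate : (xs : List ℕ) → All (_≡ 1) xs → xs ≡ List.replicate (length xs) 1
all≡1⇒replicate [] [] = refl
all≡1⇒replicate (x ∷ xs) (refl ∷ h) = cong (1 ∷_) (all≡1⇒replicate xs h)

sum-replicate-1 : ∀ a → sum (List.replicate a 1) ≡ a
sum-replicate-1 zero = refl
sum-replicate-1 (suc a) = cong suc (sum-replicate-1 a)

length≤sum : {c : List ℕ} → All (0 <_) c → length c ≤ sum c
length≤sum [] = z≤n
length≤sum (0<x ∷ 0<c) = +-mono-≤ 0<x (length≤sum 0<c)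

irrelevant-↔ : ∀ {A B : Set} → Irrelevant A → Irrelevant B → (A → B) → (B → A) → A ↔ B
irrelevant-↔ irrA irrB f g = mk↔ₛ′ f g (λ _ → irrB _ _) (λ _ → irrA _ _)

≡-injective↔ : ∀ {A B : Set} {f : A → B} → Injective _≡_ _≡_ f →
  ∀ {x y} → (f x ≡ f y) ↔ (x ≡ y)
≡-injective↔ {f = f} f-inj = irrelevant-↔ uip uip f-inj (cong f)

Σ-reindex : ∀ {I J : Set} (e : I ↔ J) (P : I → Set) → Σ I P ↔ Σ J (P ∘ Inverse.from e)
Σ-reindex e P = Σ-↔ e (K-reflexive (cong P (sym (Inverse.strictlyInverseʳ e _))))

⊎-emptyʳ : ∀ {A B : Set} → ¬ B → (A ⊎ B) ↔ A
⊎-emptyʳ ¬b = mk↔ₛ′ [ id , ⊥-elim ∘ ¬b ]′ inj₁ (λ _ → refl)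
  [ (λ _ → refl) , ⊥-elim ∘ ¬b ]

⊎-emptyˡ : ∀ {A B : Set} → ¬ A → (A ⊎ B) ↔ B
⊎-emptyˡ ¬a = mk↔ₛ′ [ ⊥-elim ∘ ¬a , id ]′ inj₂ (λ _ → refl)
  [ ⊥-elim ∘ ¬a , (λ _ → refl) ]

empty↔ : ∀ {A B : Set} → ¬ A → ¬ B → A ↔ B
empty↔ ¬a ¬b = mk↔ₛ′ (⊥-elim ∘ ¬a) (⊥-elim ∘ ¬b) (⊥-elim ∘ ¬b) (⊥-elim ∘ ¬a)

×-interchange : ∀ {A B C D : Set} → ((A × B) × (C × D)) ↔ ((A × C) × (B × D))
×-interchange = mk↔ₛ′
  (λ ((a , b) , (c , d)) → (a , c) , (b , d))
  (λ ((a , c) , (b , d)) → (a , b) , (c , d))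
  (λ _ → refl) (λ _ → refl)

×-Σ-assoc : ∀ {L B : Set} {P : B → Set} → (L × Σ B P) ↔ Σ B (λ b → L × P b)
×-Σ-assoc = mk↔ₛ′ (λ (l , b , p) → b , l , p) (λ (b , l , p) → l , b , p) (λ _ → refl) (λ _ → refl)

Fin-suc-×↔ : ∀ {B : Set} → (Fin (suc N) × B) ↔ (B ⊎ Fin N × B)
Fin-suc-×↔ {N} {B} = mk↔ₛ′ to from [ (λ _ → refl) , (λ _ → refl) ]
  λ { (zero , _) → refl ; (suc _ , _) → refl }
  where
  to : Fin (suc N) × B → B ⊎ Fin N × B
  to (zero , b) = inj₁ b
  to (suc v , b) = inj₂ (v , b)
  from : B ⊎ Fin N × B → Fin (suc N) × B
  from = [ zero ,_ , (λ (v , b) → suc v , b) ]′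

Σ-ℕ↔ : (X : ℕ → Set) → Σ ℕ X ↔ (X 0 ⊎ Σ ℕ (X ∘ suc))
Σ-ℕ↔ X = mk↔ₛ′ (λ { (zero , x) → inj₁ x ; (suc h , x) → inj₂ (h , x) }) from
  [ (λ _ → refl) , (λ _ → refl) ] (λ { (zero , x) → refl ; (suc h , x) → refl })
  where
  from : X 0 ⊎ Σ ℕ (X ∘ suc) → Σ ℕ X
  from = [ 0 ,_ , (λ (h , x) → suc h , x) ]′

Σ-List-length-zero : (R : List ℕ → Set) → Σ (List ℕ) (λ c → length c ≡ 0 × R c) ↔ R []
Σ-List-length-zero R = mk↔ₛ′ (λ { ([] , refl , r) → r }) (λ r → [] , refl , r)
  (λ _ → refl) λ { ([] , refl , r) → refl }

Σ-List-length-suc : ∀ {m} (R : List ℕ → Set) →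
  Σ (List ℕ) (λ c → length c ≡ suc m × R c) ↔
  Σ ℕ (λ h → Σ (List ℕ) (λ c → length c ≡ m × R (h ∷ c)))
Σ-List-length-suc R = mk↔ₛ′
  (λ { (h ∷ c , refl , r) → h , c , refl , r })
  (λ { (h , c , refl , r) → h ∷ c , refl , r })
  (λ { (h , c , refl , r) → refl }) (λ { (h ∷ c , refl , r) → refl })

T-injectiveᵇ : (v : Vec (Fin N) N) → T (injectiveᵇ v) ⇔ Unique (toList v)
T-injectiveᵇ v = T-does⇔ (UniqueDec.unique? Finₚ._≟_ (toList v))

app-injective : (σ : Perm N) → Injective _≡_ _≡_ (app σ)
app-injective (v , v-unique) = lookup-injective v (Equivalence.to (T-injectiveᵇ v) v-unique)

fromInjection : (g : Fin N → Fin N) → Injective _≡_ _≡_ g → Perm N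
fromInjection g g-inj = tabulate g ,
  Equivalence.from (T-injectiveᵇ (tabulate g)) (subst Unique (sym (toList-tabulate g)) (Uniqueₚ.tabulate⁺ g-inj))

app-fromInjection : (g : Fin N → Fin N) (g-inj : Injective _≡_ _≡_ g) (i : Fin N) →
  app (fromInjection g g-inj) i ≡ g i
app-fromInjection g _ = Vecₚ.lookup∘tabulate g

Perm-ext : (σ τ : Perm N) → (∀ i → app σ i ≡ app τ i) → σ ≡ τ
Perm-ext (v , p) (w , q) h
  with refl ← trans (sym (Vecₚ.tabulate∘lookup v)) (trans (Vecₚ.tabulate-cong h) (Vecₚ.tabulate∘lookup w))
  = cong (v ,_) (T-irrelevant p q)

iter-sucʳ : (σ : Perm N) (t : ℕ) (i : Fin N) → iter σ (suc t) i ≡ iter σ t (app σ i)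
iter-sucʳ σ zero i = refl
iter-sucʳ σ (suc t) i = cong (app σ) (iter-sucʳ σ t i)

iter-+ : (σ : Perm N) (s t : ℕ) (i : Fin N) → iter σ (s + t) i ≡ iter σ s (iter σ t i)
iter-+ σ zero t i = refl
iter-+ σ (suc s) t i = cong (app σ) (iter-+ σ s t i)

iter-injective : (σ : Perm N) (t : ℕ) → Injective _≡_ _≡_ (iter σ t)
iter-injective σ zero e = e
iter-injective σ (suc t) e = iter-injective σ t (app-injective σ e)

iter-returns : (σ : Perm N) (i : Fin N) → ∃ λ q → 0 < q × q ≤ N × iter σ q i ≡ i
iter-returns {N} σ i with Finₚ.pigeonhole (n<1+n N) (λ j → iter σ (toℕ j) i)
... | a , b , a<b , e = toℕ b ∸ toℕ a , m<n⇒0<n∸m a<b ,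
  ≤-trans (m∸n≤m (toℕ b) (toℕ a)) (s≤s⁻¹ (Finₚ.toℕ<n b)) , iter-injective σ (toℕ a) (begin
    iter σ (toℕ a) (iter σ (toℕ b ∸ toℕ a) i) ≡⟨ iter-+ σ (toℕ a) _ i ⟨
    iter σ (toℕ a + (toℕ b ∸ toℕ a)) i         ≡⟨ cong (λ t → iter σ t i) (m+[n∸m]≡n (<⇒≤ a<b)) ⟩
    iter σ (toℕ b) i                           ≡⟨ e ⟨
    iter σ (toℕ a) i                           ∎)
  where open ≡-Reasoning

firstOr-applyUpTo : ∀ d (p : ℕ → Bool) f n j → j < n → T (p (f j)) →
  ∃ λ i → i ≤ j × firstOr d p (applyUpTo f n) ≡ f i × T (p (f i)) × (∀ l → l < i → ¬ T (p (f l)))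
firstOr-applyUpTo d p f (suc n) j j<n pfj with p (f 0) in eq
... | true = 0 , z≤n , refl , subst T (sym eq) _ , λ _ ()
firstOr-applyUpTo d p f (suc n) zero j<n pfj | false = contradiction (subst T eq pfj) id
firstOr-applyUpTo d p f (suc n) (suc j) (s≤s j<n) pfj | false
  with i , i≤j , e , pfi , below ← firstOr-applyUpTo d p (f ∘ suc) n j j<n pfj
  = suc i , s≤s i≤j , e , pfi , λ where
      zero _ → subst T eq
      (suc l) (s≤s l<i) → below l l<i

record LeastPeriod (σ : Perm N) (i : Fin N) (q : ℕ) : Set where
  field
    positive : 0 < q
    returns  : iter σ q i ≡ i
    minimal  : ∀ t → 0 < t → t < q → iter σ t i ≢ i

cycleLen≡firstOr : (σ : Perm N) (i : Fin N) →
  cycleLen σ i ≡ firstOr N (λ t → does (iter σ t i Finₚ.≟ i)) (applyUpTo suc N)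
cycleLen≡firstOr {N} σ i = cong (firstOr N _) (Listₚ.map-applyUpTo id suc N)

cycleLen-leastPeriod : (σ : Perm N) (i : Fin N) → LeastPeriod σ i (cycleLen σ i) × cycleLen σ i ≤ N
cycleLen-leastPeriod {N} σ i with iter-returns σ i
... | suc q , _ , q<N , ret
  with j , j≤q , e , ret′ , below ← firstOr-applyUpTo N (λ t → does (iter σ t i Finₚ.≟ i)) suc N q q<N
                                      (Equivalence.from (T-does⇔ (_ Finₚ.≟ _)) ret)
  rewrite cycleLen≡firstOr σ i | e
  = record { positive = s≤s z≤n
           ; returns = Equivalence.to (T-does⇔ (_ Finₚ.≟ _)) ret′
           ; minimal = λ { (suc l) _ (s≤s l<j) → below l l<j ∘ Equivalence.from (T-does⇔ (_ Finₚ.≟ _)) } }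
  , ≤-trans (s≤s j≤q) q<N

leastPeriod-unique : {σ : Perm N} {i : Fin N} {q q′ : ℕ} →
  LeastPeriod σ i q → LeastPeriod σ i q′ → q ≡ q′
leastPeriod-unique {q = q} {q′} P P′ with <-cmp q q′
... | tri< q<q′ _ _ =
  contradiction (LeastPeriod.returns P) (LeastPeriod.minimal P′ q (LeastPeriod.positive P) q<q′)
... | tri≈ _ q≡q′ _ = q≡q′
... | tri> _ _ q′<q =
  contradiction (LeastPeriod.returns P′) (LeastPeriod.minimal P q′ (LeastPeriod.positive P′) q′<q)

cycleLen-unique : (σ : Perm N) (i : Fin N) {q : ℕ} → LeastPeriod σ i q → cycleLen σ i ≡ q
cycleLen-unique σ i = leastPeriod-unique (proj₁ (cycleLen-leastPeriod σ i))

iter-mod-cycleLen : (σ : Perm N) (i : Fin N) (t : ℕ) →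
  ∃ λ t′ → t′ < cycleLen σ i × iter σ t i ≡ iter σ t′ i
iter-mod-cycleLen σ i zero = 0 , LeastPeriod.positive P , refl
  where P = proj₁ (cycleLen-leastPeriod σ i)
iter-mod-cycleLen σ i (suc t) with iter-mod-cycleLen σ i t
... | t′ , t′<c , e with m≤n⇒m<n∨m≡n t′<c
...   | inj₁ 1+t′<c = suc t′ , 1+t′<c , cong (app σ) e
...   | inj₂ 1+t′≡c = 0 , LeastPeriod.positive P ,
          trans (cong (app σ) e) (trans (cong (λ s → iter σ s i) 1+t′≡c) (LeastPeriod.returns P))
  where P = proj₁ (cycleLen-leastPeriod σ i)

IsCycleMin : Perm N → Fin N → Set
IsCycleMin σ i = ∀ t → toℕ i ≤ toℕ (iter σ t i)

isCycleMin⇔ : (σ : Perm N) (i : Fin N) → T (isCycleMin σ i) ⇔ IsCycleMin σ i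
isCycleMin⇔ {N} σ i = mk⇔ sound (λ h → Equivalence.from (T-foldr-∧ _ (upTo N))
    (Allₚ.applyUpTo⁺₂ id N (λ t → ≤⇒≤ᵇ (h t))))
  where
  sound : T (isCycleMin σ i) → IsCycleMin σ i
  sound h t with t′ , t′<c , e ← iter-mod-cycleLen σ i t
    = subst (λ j → toℕ i ≤ toℕ j) (sym e) (≤ᵇ⇒≤ _ _
        (Allₚ.applyUpTo⁻ id N (Equivalence.to (T-foldr-∧ _ (upTo N)) h)
          (<-≤-trans t′<c (proj₂ (cycleLen-leastPeriod σ i)))))

¬isCycleMin⇒descent : (σ : Perm N) (i : Fin N) → ¬ T (isCycleMin σ i) →
  ∃ λ t → toℕ (iter σ t i) < toℕ i
¬isCycleMin⇒descent {N} σ i h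
  with t , i≰σᵗi ← satisfied (Allₚ.¬All⇒Any¬ (λ t → T? (toℕ i ≤ᵇ toℕ (iter σ t i))) (upTo N)
                                (h ∘ Equivalence.from (T-foldr-∧ _ (upTo N))))
  = t , ≰⇒> (i≰σᵗi ∘ ≤⇒≤ᵇ)

descent⇒¬isCycleMin : (σ : Perm N) (i : Fin N) (t : ℕ) → toℕ (iter σ t i) < toℕ i →
  isCycleMin σ i ≡ false
descent⇒¬isCycleMin σ i t σᵗi<i with isCycleMin σ i in eq
... | false = refl
... | true = contradiction (Equivalence.to (isCycleMin⇔ σ i) (subst T (sym eq) _) t) (<⇒≱ σᵗi<i)

isCycleMin-zero : (σ : Perm (suc N)) → isCycleMin σ zero ≡ true
isCycleMin-zero σ = Equivalence.to T-≡ (Equivalence.from (isCycleMin⇔ σ zero) (λ _ → z≤n))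

module _ (p : Fin (suc N)) (ρ : Perm (suc N)) (σ : Perm N) (x : Fin N)
         (orbit : ∀ t → iter ρ t (punchIn p x) ≡ punchIn p (iter σ t x)) where

  cycleLen-punchIn : cycleLen ρ (punchIn p x) ≡ cycleLen σ x
  cycleLen-punchIn = cycleLen-unique ρ (punchIn p x) (record
    { positive = LeastPeriod.positive P
    ; returns = trans (orbit (cycleLen σ x)) (cong (punchIn p) (LeastPeriod.returns P))
    ; minimal = λ t 0<t t<c e → LeastPeriod.minimal P t 0<t t<c
        (Finₚ.punchIn-injective p _ _ (trans (sym (orbit t)) e)) })
    where P = proj₁ (cycleLen-leastPeriod σ x)

  isCycleMin-punchIn : isCycleMin ρ (punchIn p x) ≡ isCycleMin σ x
  isCycleMin-punchIn = Bool-ext (mk⇔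
    (λ h → Equivalence.from (isCycleMin⇔ σ x) λ t → Finₚ.punchIn-cancel-≤ p _ _
      (subst (λ j → toℕ (punchIn p x) ≤ toℕ j) (orbit t) (Equivalence.to (isCycleMin⇔ ρ _) h t)))
    (λ h → Equivalence.from (isCycleMin⇔ ρ _) λ t →
      subst (λ j → toℕ (punchIn p x) ≤ toℕ j) (sym (orbit t))
        (Finₚ.punchIn-mono-≤ p _ _ (Equivalence.to (isCycleMin⇔ σ x) h t))))

-- Inserting a new point after 0

swap₀ : Fin (suc N) → Fin (suc N) → Fin (suc N)
swap₀ p y with y Finₚ.≟ zero
... | yes _ = p
... | no _ with y Finₚ.≟ p
...   | yes _ = zero
...   | no _ = y

swap₀-self : (p : Fin (suc N)) → swap₀ p p ≡ zero
swap₀-self p with p Finₚ.≟ zero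
... | yes p≡0 = p≡0
... | no _ with p Finₚ.≟ p
...   | yes _ = refl
...   | no p≢p = contradiction refl p≢p

swap₀-other : (p y : Fin (suc N)) → y ≢ zero → y ≢ p → swap₀ p y ≡ y
swap₀-other p y y≢0 y≢p with y Finₚ.≟ zero
... | yes y≡0 = contradiction y≡0 y≢0
... | no _ with y Finₚ.≟ p
...   | yes y≡p = contradiction y≡p y≢p
...   | no _ = refl

swap₀-involutive : (p y : Fin (suc N)) → swap₀ p (swap₀ p y) ≡ y
swap₀-involutive p y with y Finₚ.≟ zero
... | yes refl = swap₀-self p
... | no y≢0 with y Finₚ.≟ p
...   | yes refl = refl
...   | no y≢p = swap₀-other p y y≢0 y≢p

swap₀-injective : (p : Fin (suc N)) → Injective _≡_ _≡_ (swap₀ p)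
swap₀-injective p {i} {j} e =
  trans (sym (swap₀-involutive p i)) (trans (cong (swap₀ p) e) (swap₀-involutive p j))

fixing : Fin (suc N) → Perm N → Fin (suc N) → Fin (suc N)
fixing p σ y with p Finₚ.≟ y
... | yes _ = p
... | no p≢y = punchIn p (app σ (punchOut p≢y))

fixing-self : (p : Fin (suc N)) (σ : Perm N) → fixing p σ p ≡ p
fixing-self p σ with p Finₚ.≟ p
... | yes _ = refl
... | no p≢p = contradiction refl p≢p

fixing-punchIn : (p : Fin (suc N)) (σ : Perm N) (x : Fin N) → fixing p σ (punchIn p x) ≡ punchIn p (app σ x)
fixing-punchIn p σ x with p Finₚ.≟ punchIn p x
... | yes p≡ = contradiction (sym p≡) (Finₚ.punchInᵢ≢i p x)
... | no _ = cong (punchIn p ∘ app σ) (trans (Finₚ.punchOut-cong p refl) (Finₚ.punchOut-punchIn p))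

fixing-injective : (p : Fin (suc N)) (σ : Perm N) → Injective _≡_ _≡_ (fixing p σ)
fixing-injective p σ {i} {j} e with p Finₚ.≟ i | p Finₚ.≟ j
... | yes p≡i | yes p≡j = trans (sym p≡i) p≡j
... | yes _   | no _    = contradiction (sym e) (Finₚ.punchInᵢ≢i p _)
... | no _    | yes _   = contradiction e (Finₚ.punchInᵢ≢i p _)
... | no p≢i  | no p≢j  =
  Finₚ.punchOut-injective p≢i p≢j (app-injective σ (Finₚ.punchIn-injective p _ _ e))

-- 0 ↦ p ↦ σ(0) (relabelled): p is inserted right after 0 in the cycle of 0,
-- or becomes a new fixed point when p = 0.
insertAfter₀ : Fin (suc N) × Perm N → Perm (suc N)
insertAfter₀ (p , σ) = fromInjection (fixing p σ ∘ swap₀ p) (swap₀-injective p ∘ fixing-injective p σ)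

app-insertAfter₀ : (p : Fin (suc N)) (σ : Perm N) (y : Fin (suc N)) →
  app (insertAfter₀ (p , σ)) y ≡ fixing p σ (swap₀ p y)
app-insertAfter₀ p σ = app-fromInjection (fixing p σ ∘ swap₀ p) (swap₀-injective p ∘ fixing-injective p σ)

insertAfter₀-zero : (p : Fin (suc N)) (σ : Perm N) → app (insertAfter₀ (p , σ)) zero ≡ p
insertAfter₀-zero p σ = trans (app-insertAfter₀ p σ zero) (fixing-self p σ)

insertAfter₀-self : (v : Fin (suc N)) (σ : Perm (suc N)) →
  app (insertAfter₀ (suc v , σ)) (suc v) ≡ punchIn (suc v) (app σ zero)
insertAfter₀-self v σ = trans (app-insertAfter₀ (suc v) σ (suc v))
  (trans (cong (fixing (suc v) σ) (swap₀-self (suc v))) (fixing-punchIn (suc v) σ zero))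

insertAfter₀-punchIn : (p : Fin (suc N)) (σ : Perm N) (x : Fin N) → punchIn p x ≢ zero →
  app (insertAfter₀ (p , σ)) (punchIn p x) ≡ punchIn p (app σ x)
insertAfter₀-punchIn p σ x ≢0 = trans (app-insertAfter₀ p σ (punchIn p x))
  (trans (cong (fixing p σ) (swap₀-other p _ ≢0 (Finₚ.punchInᵢ≢i p x))) (fixing-punchIn p σ x))

module _ (ρ : Perm (suc N)) where
  private
    p = app ρ zero

  -- ρ ∘ swap₀ p fixes p, so it restricts to the points other than p
  removeAfter₀-≢ : (x : Fin N) → p ≢ app ρ (swap₀ p (punchIn p x))
  removeAfter₀-≢ x e = Finₚ.punchInᵢ≢i p x (sym
    (trans (sym (swap₀-involutive p p)) (trans (cong (swap₀ p) (swap₀-self p))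
      (trans (cong (swap₀ p) (app-injective ρ e)) (swap₀-involutive p _)))))

  restrict : Fin N → Fin N
  restrict x = punchOut (removeAfter₀-≢ x)

  restrict-injective : Injective _≡_ _≡_ restrict
  restrict-injective e = Finₚ.punchIn-injective p _ _
    (swap₀-injective p (app-injective ρ (Finₚ.punchOut-injective (removeAfter₀-≢ _) (removeAfter₀-≢ _) e)))

removeAfter₀ : Perm (suc N) → Fin (suc N) × Perm N
removeAfter₀ ρ = app ρ zero , fromInjection (restrict ρ) (restrict-injective ρ)

insertAfter₀-removeAfter₀ : (ρ : Perm (suc N)) → insertAfter₀ (removeAfter₀ ρ) ≡ ρ
insertAfter₀-removeAfter₀ ρ = Perm-ext _ ρ λ y →
  trans (app-insertAfter₀ p σ y) (trans (fixing-eq (swap₀ p y)) (cong (app ρ) (swap₀-involutive p y)))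
  where
  p = app ρ zero
  σ = fromInjection (restrict ρ) (restrict-injective ρ)
  fixing-eq : ∀ z → fixing p σ z ≡ app ρ (swap₀ p z)
  fixing-eq z with p Finₚ.≟ z
  ... | yes refl = sym (cong (app ρ) (swap₀-self p))
  ... | no p≢z = begin
    punchIn p (app σ (punchOut p≢z))
      ≡⟨ cong (punchIn p) (app-fromInjection _ (restrict-injective ρ) _) ⟩
    punchIn p (restrict ρ (punchOut p≢z))
      ≡⟨ Finₚ.punchIn-punchOut _ ⟩
    app ρ (swap₀ p (punchIn p (punchOut p≢z)))
      ≡⟨ cong (app ρ ∘ swap₀ p) (Finₚ.punchIn-punchOut p≢z) ⟩
    app ρ (swap₀ p z) ∎
    where open ≡-Reasoning

removeAfter₀-insertAfter₀ : (z : Fin (suc N) × Perm N) → removeAfter₀ (insertAfter₀ z) ≡ z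
removeAfter₀-insertAfter₀ (p , σ) = cong₂ _,_ (insertAfter₀-zero p σ) (Perm-ext _ σ λ x →
  trans (app-fromInjection _ (restrict-injective ρ) x)
    (Finₚ.punchIn-injective q _ _
      (trans (Finₚ.punchIn-punchOut (removeAfter₀-≢ ρ x)) (undo q (insertAfter₀-zero p σ)))))
  where
  ρ = insertAfter₀ (p , σ)
  q = app ρ zero
  undo : ∀ {x} q′ → q′ ≡ p → app ρ (swap₀ q′ (punchIn q′ x)) ≡ punchIn q′ (app σ x)
  undo {x} q′ refl = trans (app-insertAfter₀ p σ (swap₀ p (punchIn p x)))
    (trans (cong (fixing p σ) (swap₀-involutive p (punchIn p x))) (fixing-punchIn p σ x))

Perm-suc↔ : Perm (suc N) ↔ (Fin (suc N) × Perm N)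
Perm-suc↔ = mk↔ₛ′ removeAfter₀ insertAfter₀ removeAfter₀-insertAfter₀ insertAfter₀-removeAfter₀

Perm-suc↔⊎ : Perm (suc N) ↔ (Perm N ⊎ Fin N × Perm N)
Perm-suc↔⊎ = ↔-trans Perm-suc↔ Fin-suc-×↔

incHead : List ℕ → List ℕ
incHead [] = []
incHead (x ∷ xs) = suc x ∷ xs

incHead-injective : Injective _≡_ _≡_ incHead
incHead-injective {[]} {[]} _ = refl
incHead-injective {x ∷ xs} {y ∷ ys} e =
  cong₂ _∷_ (suc-injective (Listₚ.∷-injectiveˡ e)) (Listₚ.∷-injectiveʳ e)

filter-allFin-punchIn : (p : Fin (suc N)) (P : Fin (suc N) → Bool) → P p ≡ false →
  filter (T? ∘ P) (allFin (suc N)) ≡ filter (T? ∘ P) (map (punchIn p) (allFin N))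
filter-allFin-punchIn {N} zero P P0≡false rewrite P0≡false = cong (filter (T? ∘ P)) (tabulate-suc N)
filter-allFin-punchIn {suc N} (suc p) P Pp≡false = cong-∷ (begin
    filter (T? ∘ P) (List.tabulate Fin.suc)
      ≡⟨ cong (filter (T? ∘ P)) (tabulate-suc (suc N)) ⟩
    filter (T? ∘ P) (map suc (allFin (suc N)))
      ≡⟨ filter-map P suc _ ⟩
    map suc (filter (T? ∘ P ∘ suc) (allFin (suc N)))
      ≡⟨ cong (map suc) (filter-allFin-punchIn p (P ∘ suc) Pp≡false) ⟩
    map suc (filter (T? ∘ P ∘ suc) (map (punchIn p) (allFin N)))
      ≡⟨ filter-map P suc (map (punchIn p) (allFin N)) ⟨
    filter (T? ∘ P) (map suc (map (punchIn p) (allFin N)))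
      ≡⟨ cong (filter (T? ∘ P)) (trans (sym (Listₚ.map-∘ (allFin N))) (Listₚ.map-∘ (allFin N))) ⟩
    filter (T? ∘ P) (map (punchIn (suc p)) (map suc (allFin N)))
      ≡⟨ cong (filter (T? ∘ P) ∘ map (punchIn (suc p))) (tabulate-suc N) ⟨
    filter (T? ∘ P) (map (punchIn (suc p)) (List.tabulate Fin.suc)) ∎)
  where
  open ≡-Reasoning
  cong-∷ : ∀ {xs ys} → filter (T? ∘ P) xs ≡ filter (T? ∘ P) ys →
    filter (T? ∘ P) (zero ∷ xs) ≡ filter (T? ∘ P) (zero ∷ ys)
  cong-∷ e with P zero
  ... | true = cong (zero ∷_) e
  ... | false = e

cycleStructure-insertAfter₀-zero : (σ : Perm N) →
  cycleStructure (insertAfter₀ (zero , σ)) ≡ 1 ∷ cycleStructure σ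
cycleStructure-insertAfter₀-zero {N} σ = begin
    map (cycleLen ρ) (filter (T? ∘ isCycleMin ρ) (zero ∷ List.tabulate Fin.suc))
      ≡⟨ cong (map (cycleLen ρ)) (Listₚ.filter-accept (T? ∘ isCycleMin ρ) {x = zero}
           (Equivalence.from T-≡ (isCycleMin-zero ρ))) ⟩
    cycleLen ρ zero ∷ map (cycleLen ρ) (filter (T? ∘ isCycleMin ρ) (List.tabulate Fin.suc))
      ≡⟨ cong₂ _∷_ cycleLen-zero (cong (map (cycleLen ρ) ∘ filter (T? ∘ isCycleMin ρ)) (tabulate-suc N)) ⟩
    1 ∷ map (cycleLen ρ) (filter (T? ∘ isCycleMin ρ) (map suc (allFin N)))
      ≡⟨ cong (λ xs → 1 ∷ map (cycleLen ρ) xs) (filter-map (isCycleMin ρ) suc (allFin N)) ⟩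
    1 ∷ map (cycleLen ρ) (map suc (filter (T? ∘ isCycleMin ρ ∘ suc) (allFin N)))
      ≡⟨ cong (λ xs → 1 ∷ map (cycleLen ρ) (map suc xs)) (filter-T?-cong minima (allFin N)) ⟩
    1 ∷ map (cycleLen ρ) (map suc (filter (T? ∘ isCycleMin σ) (allFin N)))
      ≡⟨ cong (1 ∷_) (Listₚ.map-∘ _) ⟨
    1 ∷ map (cycleLen ρ ∘ suc) (filter (T? ∘ isCycleMin σ) (allFin N))
      ≡⟨ cong (1 ∷_) (Listₚ.map-cong (λ x → cycleLen-punchIn zero ρ σ x (orbit x)) _) ⟩
    1 ∷ cycleStructure σ ∎
  where
  open ≡-Reasoning
  ρ = insertAfter₀ (zero , σ)
  orbit : ∀ x t → iter ρ t (suc x) ≡ suc (iter σ t x)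
  orbit x zero = refl
  orbit x (suc t) = trans (cong (app ρ) (orbit x t)) (insertAfter₀-punchIn zero σ _ λ ())
  cycleLen-zero : cycleLen ρ zero ≡ 1
  cycleLen-zero = cycleLen-unique ρ zero (record
    { positive = s≤s z≤n
    ; returns = insertAfter₀-zero zero σ
    ; minimal = λ { t 0<t (s≤s t≤0) → contradiction (≤-trans 0<t t≤0) λ () } })
  minima : ∀ x → isCycleMin ρ (suc x) ≡ isCycleMin σ x
  minima x = isCycleMin-punchIn zero ρ σ x (orbit x)

module _ {n : ℕ} (v : Fin (suc n)) (σ : Perm (suc n)) where
  private
    p = Fin.suc v
    ρ = insertAfter₀ (p , σ)
    ι = punchIn p
    c = cycleLen σ zero
    P = proj₁ (cycleLen-leastPeriod σ zero)

    ι≡0 : ∀ y → ι y ≡ zero → y ≡ zero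
    ι≡0 y = Finₚ.punchIn-injective p y zero

    ρ-ι : ∀ y → y ≢ zero → app ρ (ι y) ≡ ι (app σ y)
    ρ-ι y y≢0 = insertAfter₀-punchIn p σ y (y≢0 ∘ ι≡0 y)

    orbit-zero : ∀ s → suc s ≤ c → iter ρ (suc (suc s)) zero ≡ ι (iter σ (suc s) zero)
    orbit-zero zero _ = trans (cong (app ρ) (insertAfter₀-zero p σ)) (insertAfter₀-self v σ)
    orbit-zero (suc s) s<c = trans (cong (app ρ) (orbit-zero s (<⇒≤ s<c)))
      (ρ-ι _ (LeastPeriod.minimal P (suc s) (s≤s z≤n) s<c))

    returns-at : ∀ s → suc s ≡ c → iter ρ (suc (suc s)) zero ≡ zero
    returns-at s e = trans (orbit-zero s (≤-reflexive e))
      (cong ι (subst (λ t → iter σ t zero ≡ zero) (sym e) (LeastPeriod.returns P)))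

    returns : iter ρ (suc c) zero ≡ zero
    returns = subst (λ t → iter ρ (suc t) zero ≡ zero) c-1+1 (returns-at (c ∸ 1) c-1+1)
      where c-1+1 = m+[n∸m]≡n (LeastPeriod.positive P)

    cycleLen-insertAfter₀-suc-zero : cycleLen ρ zero ≡ suc c
    cycleLen-insertAfter₀-suc-zero = cycleLen-unique ρ zero (record
      { positive = s≤s z≤n ; returns = returns ; minimal = minimal })
      where
      minimal : ∀ t → 0 < t → t < suc c → iter ρ t zero ≢ zero
      minimal (suc zero) _ _ e = contradiction (trans (sym (insertAfter₀-zero p σ)) e) λ ()
      minimal (suc (suc s)) _ (s≤s s<c) e = LeastPeriod.minimal P (suc s) (s≤s z≤n) s<c
        (ι≡0 _ (trans (sym (orbit-zero s (<⇒≤ s<c))) e))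

    isCycleMin-insertAfter₀-new : isCycleMin ρ p ≡ false
    isCycleMin-insertAfter₀-new = descent⇒¬isCycleMin ρ p c
      (subst (λ j → toℕ j < toℕ p) (sym ρᶜp≡0) (s≤s z≤n))
      where
      ρᶜp≡0 : iter ρ c p ≡ zero
      ρᶜp≡0 = trans (cong (iter ρ c) (sym (insertAfter₀-zero p σ)))
        (trans (sym (iter-sucʳ ρ c zero)) returns)

    -- a cycle minimum other than 0 has a cycle avoiding 0, which ρ leaves untouched
    orbit-min : ∀ x → x ≢ zero → T (isCycleMin σ x) → ∀ t → iter ρ t (ι x) ≡ ι (iter σ t x)
    orbit-min x x≢0 x-min zero = refl
    orbit-min x x≢0 x-min (suc t) = trans (cong (app ρ) (orbit-min x x≢0 x-min t)) (ρ-ι _ σᵗx≢0)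
      where
      σᵗx≢0 : iter σ t x ≢ zero
      σᵗx≢0 e = x≢0 (Finₚ.toℕ-injective (n≤0⇒n≡0
        (subst (λ j → toℕ x ≤ toℕ j) e (Equivalence.to (isCycleMin⇔ σ x) x-min t))))

    -- each ι (σᵗ x) bounds a point of the ρ-orbit of ι x, so descents of σ give descents of ρ
    orbit-below : ∀ t x → ∃ λ t′ → toℕ (iter ρ t′ (ι x)) ≤ toℕ (ι (iter σ t x))
    orbit-below zero x = 0 , ≤-refl
    orbit-below (suc t) zero = 0 , z≤n
    orbit-below (suc t) (suc x) with t′ , below ← orbit-below t (app σ (suc x)) =
      suc t′ , subst₂ (λ a b → toℕ a ≤ toℕ (ι b))
        (trans (cong (iter ρ t′) (sym (ρ-ι (suc x) λ ()))) (sym (iter-sucʳ ρ t′ (ι (suc x)))))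
        (sym (iter-sucʳ σ t (suc x))) below

    isCycleMin-insertAfter₀-punchIn : ∀ x → isCycleMin ρ (ι x) ≡ isCycleMin σ x
    isCycleMin-insertAfter₀-punchIn zero = trans (isCycleMin-zero ρ) (sym (isCycleMin-zero σ))
    isCycleMin-insertAfter₀-punchIn (suc x) with isCycleMin σ (suc x) in eq
    ... | true = trans (isCycleMin-punchIn p ρ σ (suc x) (orbit-min (suc x) (λ ()) (subst T (sym eq) _))) eq
    ... | false with t , σᵗx<x ← ¬isCycleMin⇒descent σ (suc x) (subst T eq)
                with t′ , below ← orbit-below t (suc x)
      = descent⇒¬isCycleMin ρ (ι (suc x)) t′
          (≤-<-trans below (≰⇒> (<⇒≱ σᵗx<x ∘ Finₚ.punchIn-cancel-≤ p (suc x) (iter σ t (suc x)))))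

    cycleLen-insertAfter₀-punchIn : ∀ x → x ≢ zero → T (isCycleMin σ x) →
      cycleLen ρ (ι x) ≡ cycleLen σ x
    cycleLen-insertAfter₀-punchIn x x≢0 x-min = cycleLen-punchIn p ρ σ x (orbit-min x x≢0 x-min)

  cycleStructure-insertAfter₀-suc : cycleStructure ρ ≡ incHead (cycleStructure σ)
  cycleStructure-insertAfter₀-suc = begin
      map (cycleLen ρ) (filter (T? ∘ isCycleMin ρ) (allFin (suc (suc n))))
        ≡⟨ cong (map (cycleLen ρ)) (filter-allFin-punchIn p (isCycleMin ρ) isCycleMin-insertAfter₀-new) ⟩
      map (cycleLen ρ) (filter (T? ∘ isCycleMin ρ) (map ι (allFin (suc n))))
        ≡⟨ cong (map (cycleLen ρ)) (filter-map (isCycleMin ρ) ι (allFin (suc n))) ⟩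
      map (cycleLen ρ) (map ι (filter (T? ∘ isCycleMin ρ ∘ ι) (allFin (suc n))))
        ≡⟨ cong (map (cycleLen ρ) ∘ map ι) (filter-T?-cong isCycleMin-insertAfter₀-punchIn (allFin (suc n))) ⟩
      map (cycleLen ρ) (map ι (filter (T? ∘ isCycleMin σ) (zero ∷ List.tabulate Fin.suc)))
        ≡⟨ cong (map (cycleLen ρ) ∘ map ι) σ-minima ⟩
      cycleLen ρ zero ∷ map (cycleLen ρ) (map ι F)
        ≡⟨ cong₂ _∷_ cycleLen-insertAfter₀-suc-zero
             (trans (sym (Listₚ.map-∘ F)) (Listₚ.map-cong-local lengths)) ⟩
      suc c ∷ map (cycleLen σ) F
        ≡⟨ cong (incHead ∘ map (cycleLen σ)) σ-minima ⟨
      incHead (cycleStructure σ) ∎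
    where
    open ≡-Reasoning
    F = filter (T? ∘ isCycleMin σ) (List.tabulate {n = n} Fin.suc)
    σ-minima : filter (T? ∘ isCycleMin σ) (allFin (suc n)) ≡ zero ∷ F
    σ-minima = Listₚ.filter-accept (T? ∘ isCycleMin σ) {x = zero} (Equivalence.from T-≡ (isCycleMin-zero σ))
    lengths : All (λ x → cycleLen ρ (ι x) ≡ cycleLen σ x) F
    lengths = All.zipWith (λ (x≢0 , x-min) → cycleLen-insertAfter₀-punchIn _ x≢0 x-min)
      (Allₚ.filter⁺ (T? ∘ isCycleMin σ) (Allₚ.tabulate⁺ {f = Fin.suc} λ _ ()) ,
       Allₚ.all-filter (T? ∘ isCycleMin σ) (List.tabulate Fin.suc))

-- Permutations with a prescribed ordered cycle structure

PermsOfShape : ℕ → List ℕ → Set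
PermsOfShape N d = Σ (Perm N) (λ σ → cycleStructure σ ≡ d)

PermsOfShape-suc : (d : List ℕ) → PermsOfShape (suc N) d ↔
  (Σ (Perm N) (λ σ → 1 ∷ cycleStructure σ ≡ d) ⊎
   Σ (Fin N × Perm N) (λ (_ , σ) → incHead (cycleStructure σ) ≡ d))
PermsOfShape-suc d = ↔-trans (Σ-reindex Perm-suc↔⊎ _) (↔-trans Σ-distribʳ-⊎
  (Σ-↔ ↔-refl (K-reflexive (cong (_≡ d) (cycleStructure-insertAfter₀-zero _)))
   ⊎-↔ Σ-↔ ↔-refl (λ { {v , σ} → K-reflexive (cong (_≡ d) (shape v σ)) })))
  where
  shape : ∀ {N} (v : Fin N) (σ : Perm N) →
    cycleStructure (insertAfter₀ (suc v , σ)) ≡ incHead (cycleStructure σ)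
  shape {suc _} = cycleStructure-insertAfter₀-suc

cycleStructure-positive : (σ : Perm N) → All (0 <_) (cycleStructure σ)
cycleStructure-positive σ =
  Allₚ.map⁺ (All.universal (LeastPeriod.positive ∘ proj₁ ∘ cycleLen-leastPeriod σ) _)

sum-insertAfter₀ : (z : Fin (suc N) × Perm N) → sum (cycleStructure (proj₂ z)) ≡ N →
  sum (cycleStructure (insertAfter₀ z)) ≡ suc N
sum-insertAfter₀ (zero , σ) h = trans (cong sum (cycleStructure-insertAfter₀-zero σ)) (cong suc h)
sum-insertAfter₀ {suc n} (suc v , σ) h =
  trans (cong sum (cycleStructure-insertAfter₀-suc v σ)) (sum-incHead (cycleStructure σ) h)
  where
  sum-incHead : ∀ {m} l → sum l ≡ suc m → sum (incHead l) ≡ suc (suc m)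
  sum-incHead (x ∷ xs) = cong suc

sum-cycleStructure : (σ : Perm N) → sum (cycleStructure σ) ≡ N
sum-cycleStructure {zero} σ = refl
sum-cycleStructure {suc N} ρ = subst (λ ρ → sum (cycleStructure ρ) ≡ suc N) (insertAfter₀-removeAfter₀ ρ)
  (sum-insertAfter₀ (removeAfter₀ ρ) (sum-cycleStructure (proj₂ (removeAfter₀ ρ))))

PermsOfShape-positive : {d : List ℕ} → PermsOfShape N d → All (0 <_) d
PermsOfShape-positive (σ , refl) = cycleStructure-positive σ

PermsOfShape-sum : {d : List ℕ} → PermsOfShape N d → sum d ≡ N
PermsOfShape-sum (σ , refl) = sum-cycleStructure σ

PermsOfShape-0∷ : (d : List ℕ) → ¬ PermsOfShape N (0 ∷ d)
PermsOfShape-0∷ d σ with () ∷ _ ← PermsOfShape-positive σ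

PermsOfShape-1∷ : (d : List ℕ) → PermsOfShape (suc N) (1 ∷ d) ↔ PermsOfShape N d
PermsOfShape-1∷ d = ↔-trans (PermsOfShape-suc (1 ∷ d))
  (↔-trans (⊎-emptyʳ λ (_ , e) → PermsOfShape-0∷ d (_ , incHead-injective e))
           (Σ-↔ ↔-refl (≡-injective↔ Listₚ.∷-injectiveʳ)))

PermsOfShape-2+∷ : (h : ℕ) (d : List ℕ) →
  PermsOfShape (suc N) (suc (suc h) ∷ d) ↔ (Fin N × PermsOfShape N (suc h ∷ d))
PermsOfShape-2+∷ h d = ↔-trans (PermsOfShape-suc _)
  (↔-trans (⊎-emptyˡ λ ())
  (↔-trans (Σ-↔ ↔-refl (≡-injective↔ incHead-injective)) Σ-assoc))

PermsOfShape-ones : (a : ℕ) → PermsOfShape a (List.replicate a 1) ↔ ⊤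
PermsOfShape-ones zero = mk↔ₛ′ _ (λ _ → ([] , _) , refl) (λ _ → refl)
  λ (σ , _) → Σ-≡,≡→≡ (Perm-ext _ σ (λ ()) , uip _ _)
PermsOfShape-ones (suc a) = ↔-trans (PermsOfShape-1∷ _) (PermsOfShape-ones a)

SharedShape : ℕ → List ℕ → {r : ℕ} → Vec ℕ r → Set
SharedShape K c [] = ⊤
SharedShape K c (a ∷ as) = PermsOfShape (K + a) (c ++ List.replicate a 1) × SharedShape K c as

Prefixed : ℕ → ℕ → {r : ℕ} → Vec ℕ r → Set
Prefixed K m as = Σ (List ℕ) (λ c → length c ≡ m × SharedShape K c as)

SharedShape-1∷ : ∀ K c {r} (as : Vec ℕ r) → SharedShape (suc K) (1 ∷ c) as ↔ SharedShape K c as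
SharedShape-1∷ K c [] = ↔-refl
SharedShape-1∷ K c (a ∷ as) = PermsOfShape-1∷ _ ×-↔ SharedShape-1∷ K c as

SharedShape-2+∷ : ∀ K h c {r} (as : Vec ℕ r) →
  SharedShape (suc K) (suc (suc h) ∷ c) as ↔ (Fin (fpoly as K) × SharedShape K (suc h ∷ c) as)
SharedShape-2+∷ K h c [] = mk↔ₛ′ (λ _ → zero , _) _ (λ { (zero , _) → refl }) (λ _ → refl)
SharedShape-2+∷ K h c (a ∷ as) = ↔-trans (PermsOfShape-2+∷ h _ ×-↔ SharedShape-2+∷ K h c as)
  (↔-trans ×-interchange (↔-sym Finₚ.*↔× ×-↔ ↔-refl))

SharedShape-prefix : ∀ K c {r} a (as : Vec ℕ r) → SharedShape K c (a ∷ as) → All (0 <_) c × sum c ≡ K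
SharedShape-prefix K c a as (σ , _) = Allₚ.++⁻ˡ c (PermsOfShape-positive σ) , +-cancelʳ-≡ a _ _ (begin
  sum c + a                           ≡⟨ cong (sum c +_) (sum-replicate-1 a) ⟨
  sum c + sum (List.replicate a 1)    ≡⟨ sum-++ c _ ⟨
  sum (c ++ List.replicate a 1)       ≡⟨ PermsOfShape-sum σ ⟩
  K + a                               ∎)
  where open ≡-Reasoning

SharedShape-fixedPoints : ∀ {r} (as : Vec ℕ r) → SharedShape 0 [] as ↔ ⊤
SharedShape-fixedPoints [] = ↔-refl
SharedShape-fixedPoints (a ∷ as) = ↔-trans (PermsOfShape-ones a ×-↔ SharedShape-fixedPoints as)
  (mk↔ₛ′ _ _ (λ _ → refl) (λ _ → refl))

-- the first entry of a shared prefix is positive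
Prefixed-suc↔head : ∀ K m {r} a (as : Vec ℕ r) →
  Prefixed K (suc m) (a ∷ as) ↔
  Σ ℕ (λ h → Σ (List ℕ) (λ c → length c ≡ m × SharedShape K (suc h ∷ c) (a ∷ as)))
Prefixed-suc↔head K m a as = ↔-trans (Σ-List-length-suc _) (↔-trans (Σ-ℕ↔ _)
  (⊎-emptyˡ λ (c , _ , σ , _) → PermsOfShape-0∷ _ σ))

pull-factor : ∀ {F : Set} {L R : ℕ → List ℕ → Set} →
  Σ ℕ (λ h → Σ (List ℕ) (λ c → L h c × (F × R h c))) ↔
  (F × Σ ℕ (λ h → Σ (List ℕ) (λ c → L h c × R h c)))
pull-factor = mk↔ₛ′ (λ (h , c , l , f , r) → f , h , c , l , r) (λ (f , h , c , l , r) → h , c , l , f , r)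
  (λ _ → refl) (λ _ → refl)

Prefixed-suc-suc : ∀ K m {r} a (as : Vec ℕ r) →
  Prefixed (suc K) (suc m) (a ∷ as) ↔
  (Prefixed K m (a ∷ as) ⊎ Fin (fpoly (a ∷ as) K) × Prefixed K (suc m) (a ∷ as))
Prefixed-suc-suc K m a as = ↔-trans (Prefixed-suc↔head (suc K) m a as) (↔-trans (Σ-ℕ↔ _)
  (Σ-↔ ↔-refl (↔-refl ×-↔ SharedShape-1∷ K _ (a ∷ as))
   ⊎-↔ ↔-trans (Σ-↔ ↔-refl (Σ-↔ ↔-refl (↔-refl ×-↔ SharedShape-2+∷ K _ _ (a ∷ as))))
         (↔-trans pull-factor (↔-refl ×-↔ ↔-sym (Prefixed-suc↔head K m a as)))))

¬Prefixed-suc-0 : ∀ K {r} a (as : Vec ℕ r) → ¬ Prefixed (suc K) 0 (a ∷ as)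
¬Prefixed-suc-0 K a as ([] , refl , S) with () ← proj₂ (SharedShape-prefix (suc K) [] a as S)

¬Prefixed-> : ∀ K m {r} a (as : Vec ℕ r) → K < m → ¬ Prefixed K m (a ∷ as)
¬Prefixed-> K m a as K<m (c , refl , S) with 0<c , sum≡K ← SharedShape-prefix K c a as S =
  <⇒≱ K<m (subst (length c ≤_) sum≡K (length≤sum 0<c))

Prefixed-diag : ∀ K {r} a (as : Vec ℕ r) → Prefixed K K (a ∷ as) ↔ ⊤
Prefixed-diag zero a as = ↔-trans (Σ-List-length-zero _) (SharedShape-fixedPoints (a ∷ as))
Prefixed-diag (suc K) a as = ↔-trans (Prefixed-suc-suc K K a as)
  (↔-trans (⊎-emptyʳ (¬Prefixed-> K (suc K) a as ≤-refl ∘ proj₂)) (Prefixed-diag K a as))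

Prefixed-suc-pred : ∀ K m {r} a (as : Vec ℕ r) →
  Prefixed (suc (suc K)) m (a ∷ as) ↔
  (Prefixed (suc K) (pred m) (a ∷ as) ⊎ Fin (fpoly (a ∷ as) (suc K)) × Prefixed (suc K) m (a ∷ as))
Prefixed-suc-pred K zero a as =
  empty↔ (¬Prefixed-suc-0 (suc K) a as) [ ¬Prefixed-suc-0 K a as , ¬Prefixed-suc-0 K a as ∘ proj₂ ]′
Prefixed-suc-pred K (suc m) a as = Prefixed-suc-suc (suc K) m a as

-- Elementary symmetric polynomials

private
  esymWithHead : ℕ → ℕ → List ℕ → ℕ
  esymWithHead n x xs = sum (map product (filter (λ s → length s ≟ n) (map (x ∷_) (sublists xs))))

esym-∷ : ∀ n x xs → esym n (x ∷ xs) ≡ esym n xs + esymWithHead n x xs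
esym-∷ n x xs = begin
    sum (map product (filter P (S ++ map (x ∷_) S)))
      ≡⟨ cong (sum ∘ map product) (Listₚ.filter-++ P S _) ⟩
    sum (map product (filter P S ++ filter P (map (x ∷_) S)))
      ≡⟨ cong sum (Listₚ.map-++ product (filter P S) _) ⟩
    sum (map product (filter P S) ++ map product (filter P (map (x ∷_) S)))
      ≡⟨ sum-++ (map product (filter P S)) _ ⟩
    esym n xs + esymWithHead n x xs ∎
  where
  open ≡-Reasoning
  P = λ (s : List ℕ) → length s ≟ n
  S = sublists xs

filter-length-∷ : ∀ n x (S : List (List ℕ)) →
  filter (λ s → length s ≟ suc n) (map (x ∷_) S) ≡ map (x ∷_) (filter (λ s → length s ≟ n) S)
filter-length-∷ n x [] = refl
filter-length-∷ n x (s ∷ S) with does (length s ≟ n)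
... | true = cong ((x ∷ s) ∷_) (filter-length-∷ n x S)
... | false = filter-length-∷ n x S

filter-length-0-∷ : ∀ x (S : List (List ℕ)) → filter (λ s → length s ≟ 0) (map (x ∷_) S) ≡ []
filter-length-0-∷ x [] = refl
filter-length-0-∷ x (s ∷ S) = filter-length-0-∷ x S

sum-product-∷ : ∀ x (F : List (List ℕ)) → sum (map product (map (x ∷_) F)) ≡ x * sum (map product F)
sum-product-∷ x [] = sym (*-zeroʳ x)
sum-product-∷ x (s ∷ F) =
  trans (cong (x * product s +_) (sum-product-∷ x F)) (sym (*-distribˡ-+ x (product s) _))

esym-zero : ∀ xs → esym 0 xs ≡ 1
esym-zero [] = refl
esym-zero (x ∷ xs) = begin
  esym 0 (x ∷ xs)
    ≡⟨ esym-∷ 0 x xs ⟩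
  esym 0 xs + esymWithHead 0 x xs
    ≡⟨ cong₂ _+_ (esym-zero xs) (cong (sum ∘ map product) (filter-length-0-∷ x (sublists xs))) ⟩
  1 ∎
  where open ≡-Reasoning

esym-suc-∷ : ∀ n x xs → esym (suc n) (x ∷ xs) ≡ esym (suc n) xs + x * esym n xs
esym-suc-∷ n x xs = trans (esym-∷ (suc n) x xs) (cong (esym (suc n) xs +_) (trans
  (cong (sum ∘ map product) (filter-length-∷ n x (sublists xs)))
  (sum-product-∷ x (filter (λ s → length s ≟ n) (sublists xs)))))

esym-suc-∷ʳ : ∀ n xs y → esym (suc n) (xs ++ y ∷ []) ≡ esym (suc n) xs + y * esym n xs
esym-suc-∷ʳ n [] y = esym-suc-∷ n y []
esym-suc-∷ʳ zero (x ∷ xs) y = begin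
    esym 1 (x ∷ xs′)
      ≡⟨ esym-suc-∷ 0 x xs′ ⟩
    esym 1 xs′ + x * esym 0 xs′
      ≡⟨ cong₂ (λ a b → a + x * b) (esym-suc-∷ʳ zero xs y) (esym-zero xs′) ⟩
    (A + y * esym 0 xs) + x * 1
      ≡⟨ cong (λ b → (A + y * b) + x * 1) (esym-zero xs) ⟩
    (A + y * 1) + x * 1
      ≡⟨ solve 3 (λ A y x → (A :+ y :* con 1) :+ x :* con 1 := (A :+ x :* con 1) :+ y :* con 1) refl A y x ⟩
    (A + x * 1) + y * 1
      ≡⟨ cong₂ (λ a b → (A + x * a) + y * b) (esym-zero xs) (esym-zero (x ∷ xs)) ⟨
    (A + x * esym 0 xs) + y * esym 0 (x ∷ xs)
      ≡⟨ cong (_+ y * esym 0 (x ∷ xs)) (esym-suc-∷ 0 x xs) ⟨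
    esym 1 (x ∷ xs) + y * esym 0 (x ∷ xs) ∎
  where
  open ≡-Reasoning
  xs′ = xs ++ y ∷ []
  A = esym 1 xs
esym-suc-∷ʳ (suc n) (x ∷ xs) y = begin
    esym (2 + n) (x ∷ xs′)
      ≡⟨ esym-suc-∷ (suc n) x xs′ ⟩
    esym (2 + n) xs′ + x * esym (suc n) xs′
      ≡⟨ cong₂ (λ a b → a + x * b) (esym-suc-∷ʳ (suc n) xs y) (esym-suc-∷ʳ n xs y) ⟩
    (A + y * B) + x * (B + y * C)
      ≡⟨ solve 5 (λ A B C x y → (A :+ y :* B) :+ x :* (B :+ y :* C) := (A :+ x :* B) :+ y :* (B :+ x :* C))
           refl A B C x y ⟩
    (A + x * B) + y * (B + x * C)
      ≡⟨ cong₂ (λ a b → a + y * b) (esym-suc-∷ (suc n) x xs) (esym-suc-∷ n x xs) ⟨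
    esym (2 + n) (x ∷ xs) + y * esym (suc n) (x ∷ xs) ∎
  where
  open ≡-Reasoning
  xs′ = xs ++ y ∷ []
  A = esym (2 + n) xs
  B = esym (suc n) xs
  C = esym n xs

oneTo-suc : ∀ k → oneTo (suc k) ≡ oneTo k ++ suc k ∷ []
oneTo-suc k = trans (cong (map suc) (sym (Listₚ.upTo-∷ʳ k))) (Listₚ.map-++ suc (upTo k) (k ∷ []))

HasPrefix : List ℕ → List ℕ × ℕ → Set
HasPrefix c (d , a) = d ≡ c ++ List.replicate a 1

Tail : ℕ → List ℕ × ℕ → Set
Tail m (d , a) = All (_≡ 1) (List.drop m d) × length d ≡ m + a

prefix⇒tail : ∀ {c m} → length c ≡ m → ∀ d a → HasPrefix c (d , a) → Tail m (d , a)
prefix⇒tail {c} refl d a refl =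
  subst (All (_≡ 1)) (sym (drop-length-++ c _)) (Allₚ.replicate⁺ a refl) ,
  trans (Listₚ.length-++ c) (cong (length c +_) (Listₚ.length-replicate a))

prefix⇒take : ∀ {c m} → length c ≡ m → ∀ d a → HasPrefix c (d , a) → List.take m d ≡ c
prefix⇒take {c} refl d a refl = take-length-++ c _

tail⇒prefix : ∀ {m c} d a → List.take m d ≡ c → Tail m (d , a) → HasPrefix c (d , a)
tail⇒prefix {m} d a refl (ones , len) = begin
  d                                                   ≡⟨ Listₚ.take++drop≡id m d ⟨
  List.take m d ++ List.drop m d                      ≡⟨ cong (List.take m d ++_) (all≡1⇒replicate _ ones) ⟩
  List.take m d ++ List.replicate (length (List.drop m d)) 1
    ≡⟨ cong (λ n → List.take m d ++ List.replicate n 1)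
         (trans (Listₚ.length-drop m d) (trans (cong (_∸ m) len) (m+n∸m≡n m a))) ⟩
  List.take m d ++ List.replicate a 1                 ∎
  where open ≡-Reasoning

SamePrefix : ℕ → List ℕ × ℕ → List ℕ × ℕ → Set
SamePrefix m p q = SameUpTo m (proj₁ p) (proj₁ q)

prefix⇒good : ∀ {c m} → length c ≡ m → (L : List (List ℕ × ℕ)) →
  All (HasPrefix c) L → AllPairs (SamePrefix m) L × All (Tail m) L
prefix⇒good {c} {m} len L hs = pairs L hs , All.map (λ {(d , a)} → prefix⇒tail len d a) hs
  where
  same : ∀ {p q} → HasPrefix c p → HasPrefix c q → SamePrefix m p q
  same {d , a} {d′ , a′} hp hq = trans (prefix⇒take len d a hp) (sym (prefix⇒take len d′ a′ hq)) ,
    proj₁ (prefix⇒tail len d a hp) , proj₁ (prefix⇒tail len d′ a′ hq)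
  pairs : ∀ L → All (HasPrefix c) L → AllPairs (SamePrefix m) L
  pairs [] [] = []
  pairs (p ∷ L) (hp ∷ hs) = All.map (same hp) hs ∷ pairs L hs

good⇒prefix : ∀ {m} p (L : List (List ℕ × ℕ)) →
  AllPairs (SamePrefix m) (p ∷ L) → All (Tail m) (p ∷ L) → All (HasPrefix (List.take m (proj₁ p))) (p ∷ L)
good⇒prefix (d , a) L (sames ∷ _) (tp ∷ ts) =
  tail⇒prefix d a refl tp ∷
  All.zipWith (λ { {d′ , a′} (s , t) → tail⇒prefix d′ a′ (sym (proj₁ s)) t }) (sames , ts)

SharedPrefix : (k m : ℕ) {r : ℕ} (as : Vec ℕ r) → Tuples k as → Set
SharedPrefix k m as τ = Σ (List ℕ) (λ c → length c ≡ m × All (HasPrefix c) (structures k as τ))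

SharedPrefix-irrelevant : ∀ k m {r} a (as : Vec ℕ r) τ → Irrelevant (SharedPrefix k m (a ∷ as) τ)
SharedPrefix-irrelevant k m a as (σ , τ) (c , len , h ∷ hs) (c′ , len′ , h′ ∷ hs′)
  with refl ← trans (sym (prefix⇒take len (cycleStructure σ) a h))
                    (prefix⇒take len′ (cycleStructure σ) a h′)
  = cong₂ (λ l h → c , l , h) (uip len len′) (All.irrelevant uip (h ∷ hs) (h′ ∷ hs′))

Good-irrelevant : ∀ k m {r} (as : Vec ℕ r) τ → Irrelevant (Good k m as τ)
Good-irrelevant k m as τ (same , tails) (same′ , tails′) =
  cong₂ _,_ (AllPairs.irrelevant (λ {p} {q} → sameIrr {p} {q}) same same′)
            (All.irrelevant (λ {p} → tailIrr {p}) tails tails′)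
  where
  sameIrr : ∀ {p q} → Irrelevant (SamePrefix m p q)
  sameIrr (e , o , o′) (f , u , u′) =
    cong₂ _,_ (uip e f) (cong₂ _,_ (All.irrelevant uip o u) (All.irrelevant uip o′ u′))
  tailIrr : ∀ {p} → Irrelevant (Tail m p)
  tailIrr (o , e) (u , f) = cong₂ _,_ (All.irrelevant uip o u) (uip e f)

Good↔SharedPrefix : ∀ k m {r} a (as : Vec ℕ r) τ → Good k m (a ∷ as) τ ↔ SharedPrefix k m (a ∷ as) τ
Good↔SharedPrefix k m a as τ@(σ , _) =
  irrelevant-↔ (Good-irrelevant k m (a ∷ as) τ) (SharedPrefix-irrelevant k m a as τ)
  (λ (same , tails) → List.take m (cycleStructure σ) ,
     trans (Listₚ.length-take m _) (m≤n⇒m⊓n≡m (subst (m ≤_) (sym (proj₂ (All.head tails))) (m≤m+n m a))) ,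
     good⇒prefix _ _ same tails)
  (λ (c , len , hs) → prefix⇒good len _ hs)

SharedShape↔Tuples : ∀ k c {r} (as : Vec ℕ r) →
  SharedShape (k + 1) c as ↔ Σ (Tuples k as) (λ τ → All (HasPrefix c) (structures k as τ))
SharedShape↔Tuples k c [] = mk↔ₛ′ (λ _ → _ , []) _ (λ { (_ , []) → refl }) (λ _ → refl)
SharedShape↔Tuples k c (a ∷ as) = mk↔ₛ′
  (λ ((σ , e) , S) → let τ , hs = to S in (σ , τ) , e ∷ hs)
  (λ { ((σ , τ) , e ∷ hs) → (σ , e) , from (τ , hs) })
  (λ { ((σ , τ) , e ∷ hs) →
        cong (λ (τ , hs) → (σ , τ) , e ∷ hs) (Inverse.strictlyInverseˡ rest (τ , hs)) })
  (λ ((σ , e) , S) → cong ((σ , e) ,_) (Inverse.strictlyInverseʳ rest S))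
  where
  rest = SharedShape↔Tuples k c as
  open Inverse rest using (to; from)

Prefixed↔Good : ∀ k m {r} a (as : Vec ℕ r) →
  Prefixed (k + 1) m (a ∷ as) ↔ Σ (Tuples k (a ∷ as)) (Good k m (a ∷ as))
Prefixed↔Good k m a as =
  ↔-trans (Σ-↔ ↔-refl (↔-trans (↔-refl ×-↔ SharedShape↔Tuples k _ (a ∷ as)) ×-Σ-assoc))
  (↔-trans (∃∃↔∃∃ _) (Σ-↔ ↔-refl (↔-sym (Good↔SharedPrefix k m a as _))))

esym↔Prefixed : ∀ {r} a (as : Vec ℕ r) k n →
  Fin (esym n (map (fpoly (a ∷ as)) (oneTo k))) ↔ Prefixed (suc k) (suc k ∸ n) (a ∷ as)
esym↔Prefixed a as k zero =
  ↔-trans (K-reflexive (cong Fin (esym-zero (map (fpoly (a ∷ as)) (oneTo k)))))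
    (↔-trans Finₚ.1↔⊤ (↔-sym (Prefixed-diag (suc k) a as)))
esym↔Prefixed a as zero (suc n) =
  empty↔ (λ ()) (subst (λ m → ¬ Prefixed 1 m (a ∷ as)) (sym (0∸n≡0 n)) (¬Prefixed-suc-0 0 a as))
esym↔Prefixed a as (suc k) (suc n) = begin
  Fin (esym (suc n) (map f (oneTo (suc k))))
    ≡⟨ cong (λ xs → Fin (esym (suc n) xs)) (trans (cong (map f) (oneTo-suc k)) (Listₚ.map-++ f (oneTo k) _)) ⟩
  Fin (esym (suc n) (xs ++ f (suc k) ∷ []))
    ≡⟨ cong Fin (esym-suc-∷ʳ n xs (f (suc k))) ⟩
  Fin (esym (suc n) xs + f (suc k) * esym n xs)
    ↔⟨ ↔-trans Finₚ.+↔⊎ (↔-refl ⊎-↔ Finₚ.*↔×) ⟩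
  (Fin (esym (suc n) xs) ⊎ Fin (f (suc k)) × Fin (esym n xs))
    ↔⟨ esym↔Prefixed a as k (suc n) ⊎-↔ (↔-refl ×-↔ esym↔Prefixed a as k n) ⟩
  (Prefixed (suc k) (suc k ∸ suc n) (a ∷ as) ⊎ Fin (f (suc k)) × Prefixed (suc k) (suc k ∸ n) (a ∷ as))
    ≡⟨ cong (λ m → Prefixed (suc k) m (a ∷ as) ⊎ Fin (f (suc k)) × Prefixed (suc k) (suc k ∸ n) (a ∷ as))
            (pred[m∸n]≡m∸[1+n] (suc k) n) ⟨
  (Prefixed (suc k) (pred (suc k ∸ n)) (a ∷ as) ⊎ Fin (f (suc k)) × Prefixed (suc k) (suc k ∸ n) (a ∷ as))
    ↔⟨ ↔-sym (Prefixed-suc-pred k (suc k ∸ n) a as) ⟩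
  Prefixed (suc (suc k)) (suc k ∸ n) (a ∷ as) ∎
  where
  open EquationalReasoning
  f = fpoly (a ∷ as)
  xs = map f (oneTo k)

corollaryC : (r : ℕ) → 1 ≤ r → (as : Vec ℕ r) → (n k : ℕ) →
    Fin (esym n (map (fpoly as) (oneTo k))) ↔ Σ (Tuples k as) (Good k (k + 1 ∸ n) as)
corollaryC zero () _ _ _
corollaryC (suc r) _ (a ∷ as) n k = begin
  Fin (esym n (map (fpoly (a ∷ as)) (oneTo k)))       ↔⟨ esym↔Prefixed a as k n ⟩
  Prefixed (suc k) (suc k ∸ n) (a ∷ as)               ≡⟨ cong (λ K → Prefixed K (K ∸ n) (a ∷ as)) (+-comm 1 k) ⟩
  Prefixed (k + 1) (k + 1 ∸ n) (a ∷ as)               ↔⟨ Prefixed↔Good k (k + 1 ∸ n) a as ⟩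
  Σ (Tuples k (a ∷ as)) (Good k (k + 1 ∸ n) (a ∷ as)) ∎
  where open EquationalReasoning
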